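{- Let $p$ be a prime and suppose $\overline{C}_1(\overline{x}),\dots,\overline{C}_k(\overline{x})$ are Boolean circuits each with $b$ inputs and $b$ outputs, each of size at most $s$. Suppose that for each $i$ there is an IPS (over $\mathbb{F}_p$) derivation of $\mathrm{VAL}_p(\overline{C}_i(\overline{x}))-\mathrm{VAL}_p(\overline{x})$ of size $t_i$ from the Boolean axioms. Then there is an IPS derivation of $\mathrm{VAL}_p(\overline{C}_1(\overline{C}_2(\cdots(\overline{C}_k(\overline{x})))))-\mathrm{VAL}_p(\overline{x})$ from the Boolean axioms of size $\sum_{i=1}^k t_i+k\cdot\mathrm{poly}(s)$.
   Context: For a bit vector $\overline{x}=x_{b-1}\dots x_0$, $\mathrm{VAL}_p(\overline{x})=\sum_{i=0}^{b-1}(2^i\bmod p)x_i$, an algebraic circuit over $\mathbb{F}_p$; Boolean circuit outputs inside $\mathrm{VAL}_p$ are replaced by their algebraic translations ($\mathrm{alg}(x)=x$, $\mathrm{alg}(\neg\psi)=1-\mathrm{alg}(\psi)$, $\mathrm{alg}(\psi\wedge\chi)=\mathrm{alg}(\psi)\mathrm{alg}(\chi)$, $\mathrm{alg}(\psi\vee\chi)=1-(1-\mathrm{alg}(\psi))(1-\mathrm{alg}(\chi))$). Boolean axioms: $x_i^2-x_i$. An IPS derivation of $G$ from $F_1,\dots,F_r$ is an algebraic circuit computing $P(\overline{x},\overline{y})$ with $P(\overline{x},F_1,\dots,F_r)=G$ and $P(\overline{x},\overline{0})=0$; size is circuit size. The $\mathrm{poly}(s)$ term denotes a fixed polynomial in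 $s$ independent of $k$. -}

module Defs where

open import Data.Nat using (ℕ; zero; suc; _+_; _*_; _^_; _≤_)
open import Data.Nat.DivMod using (_%_)
open import Data.Nat.Primality using (Prime; prime⇒nonZero)
open import Data.Fin using (Fin; zero; suc; toℕ)
open import Data.Sum using (_⊎_; inj₁; inj₂)
open import Function using (_∘_)

infixl 6 _⊕_
infixl 7 _⊗_

data Expr (V : Set) : Set where
  var  : V → Expr V
  con  : ℕ → Expr V                 -- the constant (n mod p) of F_p
  neg  : Expr V → Expr V
  _⊕_  : Expr V → Expr V → Expr V
  _⊗_  : Expr V → Expr V → Expr V

_⊖_ : ∀ {V} → Expr V → Expr V → Expr V
a ⊖ b = a ⊕ neg b

-- Equality of polynomials over F_p: the congruence generated by the
-- commutative-ring axioms, the interpretation of natural-number constants,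
-- and characteristic p.  Expr V modulo this relation is F_p[V].
data PolyEq {V : Set} (p : ℕ) : Expr V → Expr V → Set where
  ≈-refl   : ∀ {a} → PolyEq p a a
  ≈-sym    : ∀ {a b} → PolyEq p a b → PolyEq p b a
  ≈-trans  : ∀ {a b c} → PolyEq p a b → PolyEq p b c → PolyEq p a c
  ⊕-cong   : ∀ {a a′ b b′} → PolyEq p a a′ → PolyEq p b b′ → PolyEq p (a ⊕ b) (a′ ⊕ b′)
  ⊗-cong   : ∀ {a a′ b b′} → PolyEq p a a′ → PolyEq p b b′ → PolyEq p (a ⊗ b) (a′ ⊗ b′)
  neg-cong : ∀ {a a′} → PolyEq p a a′ → PolyEq p (neg a) (neg a′)
  ⊕-assoc  : ∀ a b c → PolyEq p ((a ⊕ b) ⊕ c) (a ⊕ (b ⊕ c))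
  ⊕-comm   : ∀ a b → PolyEq p (a ⊕ b) (b ⊕ a)
  ⊕-idˡ    : ∀ a → PolyEq p (con 0 ⊕ a) a
  ⊕-invʳ   : ∀ a → PolyEq p (a ⊕ neg a) (con 0)
  ⊗-assoc  : ∀ a b c → PolyEq p ((a ⊗ b) ⊗ c) (a ⊗ (b ⊗ c))
  ⊗-comm   : ∀ a b → PolyEq p (a ⊗ b) (b ⊗ a)
  ⊗-idˡ    : ∀ a → PolyEq p (con 1 ⊗ a) a
  distribˡ : ∀ a b c → PolyEq p (a ⊗ (b ⊕ c)) ((a ⊗ b) ⊕ (a ⊗ c))
  con-+    : ∀ m n → PolyEq p (con (m + n)) (con m ⊕ con n)
  con-*    : ∀ m n → PolyEq p (con (m * n)) (con m ⊗ con n)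
  char     : PolyEq p (con p) (con 0)

subst : ∀ {V W} → (V → Expr W) → Expr V → Expr W
subst σ (var v) = σ v
subst σ (con n) = con n
subst σ (neg a) = neg (subst σ a)
subst σ (a ⊕ b) = subst σ a ⊕ subst σ b
subst σ (a ⊗ b) = subst σ a ⊗ subst σ b

sumE : ∀ {V} (b : ℕ) → (Fin b → Expr V) → Expr V
sumE zero    f = con 0
sumE (suc b) f = f zero ⊕ sumE b (f ∘ suc)

sumℕ : (k : ℕ) → (Fin k → ℕ) → ℕ
sumℕ zero    f = 0
sumℕ (suc k) f = f zero + sumℕ k (f ∘ suc)

-- Algebraic circuits over F_p: straight-line programs (DAGs).
-- A gate of a program with i earlier gates refers to earlier gates by
-- Fin i (index zero = most recent gate).

data AGate (V : Set) (i : ℕ) : Set where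
  gvar : V → AGate V i
  gcon : ℕ → AGate V i
  gadd : Fin i → Fin i → AGate V i
  gmul : Fin i → Fin i → AGate V i

data ASLP (V : Set) : ℕ → Set where
  []  : ASLP V 0
  _▷_ : ∀ {i} → ASLP V i → AGate V i → ASLP V (suc i)

extend : ∀ {A : Set} {i} → (Fin i → A) → A → Fin (suc i) → A
extend f e zero    = e
extend f e (suc j) = f j

agates : ∀ {V i} → ASLP V i → Fin i → Expr V
agates []      ()
agates (c ▷ g) = extend (agates c) (gate g)
  where
  gate : AGate _ _ → Expr _
  gate (gvar v)   = var v
  gate (gcon n)   = con n
  gate (gadd j l) = agates c j ⊕ agates c l
  gate (gmul j l) = agates c j ⊗ agates c l

record AlgCircuit (V : Set) : Set where
  constructor mkAlg
  field
    m     : ℕ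
    gates : ASLP V (suc m)

  size : ℕ
  size = suc m

  output : Expr V
  output = agates gates zero

record IPS (p b r : ℕ) (F : Fin r → Expr (Fin b)) (G : Expr (Fin b)) : Set where
  field
    circuit : AlgCircuit (Fin b ⊎ Fin r)
    derives : PolyEq p (subst (λ { (inj₁ i) → var i ; (inj₂ j) → F j })
                              (AlgCircuit.output circuit)) G
    vanishes : PolyEq p (subst (λ { (inj₁ i) → var i ; (inj₂ j) → con 0 })
                               (AlgCircuit.output circuit)) (con 0)

  size : ℕ
  size = AlgCircuit.size circuit

boolAx : (b : ℕ) → Fin b → Expr (Fin b)
boolAx b i = (var i ⊗ var i) ⊖ var i

data BGate (b i : ℕ) : Set where
  binp : Fin b → BGate b i
  bnot : Fin i → BGate b i
  band : Fin i → Fin i → BGate b i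
  bor  : Fin i → Fin i → BGate b i

data BSLP (b : ℕ) : ℕ → Set where
  []  : BSLP b 0
  _▷_ : ∀ {i} → BSLP b i → BGate b i → BSLP b (suc i)

record BoolCircuit (b : ℕ) : Set where
  constructor mkBool
  field
    size  : ℕ                 -- number of gates (including input gates)
    gates : BSLP b size
    out   : Fin b → Fin size

algGates : ∀ {V b i} → BSLP b i → (Fin b → Expr V) → Fin i → Expr V
algGates []      ins ()
algGates (c ▷ g) ins = extend (algGates c ins) (gate g)
  where
  gate : BGate _ _ → Expr _
  gate (binp j)   = ins j
  gate (bnot j)   = con 1 ⊖ algGates c ins j
  gate (band j l) = algGates c ins j ⊗ algGates c ins l
  gate (bor j l)  = con 1 ⊖ ((con 1 ⊖ algGates c ins j) ⊗ (con 1 ⊖ algGates c ins l))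

algOut : ∀ {V b} → BoolCircuit b → (Fin b → Expr V) → Fin b → Expr V
algOut C ins o = algGates (BoolCircuit.gates C) ins (BoolCircuit.out C o)

-- C_0(C_1(...(C_{k-1}(ins))))   (C_0 outermost)
compose : ∀ {V b} (k : ℕ) → (Fin k → BoolCircuit b) → (Fin b → Expr V) → Fin b → Expr V
compose zero    Cs ins = ins
compose (suc k) Cs ins = algOut (Cs zero) (compose k (Cs ∘ suc) ins)

VAL : ∀ {V b} (p : ℕ) → Prime p → (Fin b → Expr V) → Expr V
VAL {b = b} p pr xs =
  sumE b (λ i → con (_%_ (2 ^ toℕ i) p {{prime⇒nonZero pr}}) ⊗ xs i)

-- An IPS derivation is kept as an algebraic circuit over the variables x and
-- placeholders y for the Boolean axioms.  If P derives VAL(C(x)) − VAL(x), then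
-- substituting x := T and y_j := a derivation of T_j² − T_j turns P into a
-- derivation of VAL(C(T)) − VAL(T).  Taking T = C_{i+1}(⋯C_k(x)) for the i-th
-- circuit and adding the k instances, the sum telescopes to
-- VAL(C_1(⋯C_k(x))) − VAL(x).  All intermediate values are shared gates, so level
-- i costs t_i plus the translation of C_i; a Boolean gate is translated together
-- with a derivation of the Booleanity of its output in a bounded number of gates,
-- using (1 − A)² − (1 − A) = A² − A, (AB)² − AB = B²(A² − A) + A(B² − B) and
-- A ∨ B = ¬(¬A ∧ ¬B).
module Submission where

open import Defs
open import Algebra.Bundles using (CommutativeRing; RawRing)
import Algebra.Consequences.Setoid as Consequences
open import Algebra.Solver.Ring.AlmostCommutativeRing
  using (fromCommutativeRing; _-Raw-AlmostCommutative⟶_)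
open import Data.Maybe using (just; nothing)
open import Data.Nat using (ℕ; zero; suc)
open import Data.Nat.Primality using (Prime; prime⇒nonZero)
open import Data.Product using (Σ; _×_; _,_; proj₁)
open import Data.Product.Properties using (≡-dec)
import Data.Nat as ℕ
import Data.Nat.Properties as ℕ
open import Level using (0ℓ)
open import Relation.Binary.Definitions using (WeaklyDecidable)
open import Relation.Binary.Structures using (IsEquivalence)
open import Relation.Binary.Bundles using (Setoid)
open import Relation.Binary.PropositionalEquality as ≡ using (_≡_)
open import Relation.Nullary using (yes; no)

module IntegerCoefficients {c ℓ} (R : CommutativeRing c ℓ) where
  open CommutativeRing R hiding (zero)

  open import Algebra.Properties.Ring ring using (x[y-z]≈xy-xz; [y-z]x≈yx-zx)
  open import Algebra.Properties.Group +-group using (ε⁻¹≈ε)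
  open import Algebra.Properties.AbelianGroup +-abelianGroup
    using (⁻¹-∙-comm; ⁻¹-anti-homo‿-)
  open import Algebra.Properties.CommutativeSemigroup +-commutativeSemigroup
    using (interchange)
  open import Relation.Binary.Reasoning.Setoid setoid

  diff-+ : ∀ x y u v → (x + y) - (u + v) ≈ (x - u) + (y - v)
  diff-+ x y u v = trans (+-congˡ (sym (⁻¹-∙-comm u v))) (interchange x y (- u) (- v))

  diff-diff : ∀ x y u v → (x - y) - (u - v) ≈ (x + v) - (y + u)
  diff-diff x y u v = begin
    (x - y) - (u - v)        ≈⟨ +-congˡ (⁻¹-anti-homo‿- u v) ⟩
    (x - y) + (v - u)        ≈⟨ interchange x (- y) v (- u) ⟩
    (x + v) + (- y + - u)    ≈⟨ +-congˡ (⁻¹-∙-comm y u) ⟩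
    (x + v) - (y + u)        ∎

  diff-* : ∀ x y u v → (x - y) * (u - v) ≈ (x * u + y * v) - (x * v + y * u)
  diff-* x y u v = begin
    (x - y) * (u - v)                   ≈⟨ [y-z]x≈yx-zx (u - v) x y ⟩
    x * (u - v) - y * (u - v)           ≈⟨ +-cong (x[y-z]≈xy-xz x u v) (-‿cong (x[y-z]≈xy-xz y u v)) ⟩
    (x * u - x * v) - (y * u - y * v)   ≈⟨ diff-diff (x * u) (x * v) (y * u) (y * v) ⟩
    (x * u + y * v) - (x * v + y * u)   ∎

  diff-cancelˡ : ∀ x y z → (x + y) - (x + z) ≈ y - z
  diff-cancelˡ x y z = begin
    (x + y) - (x + z)    ≈⟨ diff-+ x y x z ⟩
    (x - x) + (y - z)    ≈⟨ +-congʳ (-‿inverseʳ x) ⟩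
    0# + (y - z)         ≈⟨ +-identityˡ (y - z) ⟩
    y - z                ∎

  -- The ring solver needs coefficients with (weakly) decidable equality: integers
  -- as normalised differences of naturals, mapped into R through the ℕ-embedding ι.
  module Solver
    (ι : ℕ → Carrier)
    (ι-+ : ∀ m n → ι (m ℕ.+ n) ≈ ι m + ι n)
    (ι-* : ∀ m n → ι (m ℕ.* n) ≈ ι m * ι n)
    (ι-0 : ι 0 ≈ 0#)
    (ι-1 : ι 1 ≈ 1#)
    where

    Difference : Set
    Difference = ℕ × ℕ

    normalise : ℕ → ℕ → Difference
    normalise (suc a) (suc b) = normalise a b
    normalise a       b       = a , b

    differences : RawRing 0ℓ 0ℓ
    differences = record
      { Carrier = Difference
      ; _≈_     = _≡_
      ; _+_     = λ { (a , b) (u , v) → normalise (a ℕ.+ u) (b ℕ.+ v) }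
      ; _*_     = λ { (a , b) (u , v) → normalise (a ℕ.* u ℕ.+ b ℕ.* v) (a ℕ.* v ℕ.+ b ℕ.* u) }
      ; -_      = λ { (a , b) → b , a }
      ; 0#      = 0 , 0
      ; 1#      = 1 , 0
      }

    ⟦_⟧ : Difference → Carrier
    ⟦ a , zero  ⟧ = ι a
    ⟦ a , suc b ⟧ = ι a - ι (suc b)

    ⟦⟧≈- : ∀ a b → ⟦ a , b ⟧ ≈ ι a - ι b
    ⟦⟧≈- a zero    = sym (trans (+-congˡ (trans (-‿cong ι-0) ε⁻¹≈ε)) (+-identityʳ (ι a)))
    ⟦⟧≈- a (suc b) = refl

    normalise≈- : ∀ a b → ⟦ normalise a b ⟧ ≈ ι a - ι b
    normalise≈- (suc a) (suc b) = begin
      ⟦ normalise a b ⟧                ≈⟨ normalise≈- a b ⟩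
      ι a - ι b                        ≈⟨ diff-cancelˡ (ι 1) (ι a) (ι b) ⟨
      (ι 1 + ι a) - (ι 1 + ι b)        ≈⟨ +-cong (ι-+ 1 a) (-‿cong (ι-+ 1 b)) ⟨
      ι (suc a) - ι (suc b)            ∎
    normalise≈- zero    b       = ⟦⟧≈- zero b
    normalise≈- (suc a) zero    = ⟦⟧≈- (suc a) zero

    embedding : differences -Raw-AlmostCommutative⟶ fromCommutativeRing R
    embedding = record
      { ⟦_⟧    = ⟦_⟧
      ; +-homo = +-homo
      ; *-homo = *-homo
      ; -‿homo = λ { (a , b) → -‿homo a b }
      ; 0-homo = ι-0
      ; 1-homo = ι-1
      }
      where
      +-homo : ∀ x y → ⟦ RawRing._+_ differences x y ⟧ ≈ ⟦ x ⟧ + ⟦ y ⟧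
      +-homo (a , b) (u , v) = begin
        ⟦ normalise (a ℕ.+ u) (b ℕ.+ v) ⟧   ≈⟨ normalise≈- (a ℕ.+ u) (b ℕ.+ v) ⟩
        ι (a ℕ.+ u) - ι (b ℕ.+ v)           ≈⟨ +-cong (ι-+ a u) (-‿cong (ι-+ b v)) ⟩
        (ι a + ι u) - (ι b + ι v)           ≈⟨ diff-+ (ι a) (ι u) (ι b) (ι v) ⟩
        (ι a - ι b) + (ι u - ι v)           ≈⟨ +-cong (⟦⟧≈- a b) (⟦⟧≈- u v) ⟨
        ⟦ a , b ⟧ + ⟦ u , v ⟧               ∎
      *-homo : ∀ x y → ⟦ RawRing._*_ differences x y ⟧ ≈ ⟦ x ⟧ * ⟦ y ⟧
      *-homo (a , b) (u , v) = begin
        ⟦ normalise (a ℕ.* u ℕ.+ b ℕ.* v) (a ℕ.* v ℕ.+ b ℕ.* u) ⟧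
          ≈⟨ normalise≈- (a ℕ.* u ℕ.+ b ℕ.* v) (a ℕ.* v ℕ.+ b ℕ.* u) ⟩
        ι (a ℕ.* u ℕ.+ b ℕ.* v) - ι (a ℕ.* v ℕ.+ b ℕ.* u)
          ≈⟨ +-cong (ι-+-* a u b v) (-‿cong (ι-+-* a v b u)) ⟩
        (ι a * ι u + ι b * ι v) - (ι a * ι v + ι b * ι u)
          ≈⟨ diff-* (ι a) (ι b) (ι u) (ι v) ⟨
        (ι a - ι b) * (ι u - ι v)
          ≈⟨ *-cong (⟦⟧≈- a b) (⟦⟧≈- u v) ⟨
        ⟦ a , b ⟧ * ⟦ u , v ⟧ ∎
        where
        ι-+-* : ∀ a u b v → ι (a ℕ.* u ℕ.+ b ℕ.* v) ≈ ι a * ι u + ι b * ι v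
        ι-+-* a u b v = trans (ι-+ (a ℕ.* u) (b ℕ.* v)) (+-cong (ι-* a u) (ι-* b v))
      -‿homo : ∀ a b → ⟦ b , a ⟧ ≈ - ⟦ a , b ⟧
      -‿homo a b = begin
        ⟦ b , a ⟧        ≈⟨ ⟦⟧≈- b a ⟩
        ι b - ι a        ≈⟨ ⁻¹-anti-homo‿- (ι a) (ι b) ⟨
        - (ι a - ι b)    ≈⟨ -‿cong (⟦⟧≈- a b) ⟨
        - ⟦ a , b ⟧      ∎

    _≟_ : WeaklyDecidable (λ x y → ⟦ x ⟧ ≈ ⟦ y ⟧)
    x ≟ y with ≡-dec ℕ._≟_ ℕ._≟_ x y
    ... | yes ≡.refl = just refl
    ... | no _       = nothing

    open import Algebra.Solver.Ring differences (fromCommutativeRing R) embedding _≟_ public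
      using (solve; _:=_; _:+_; _:*_; _:-_) renaming (con to K)

polyCommutativeRing : ℕ → Set → CommutativeRing 0ℓ 0ℓ
polyCommutativeRing p V = record
  { Carrier           = Expr V
  ; _≈_               = PolyEq p
  ; _+_               = _⊕_
  ; _*_               = _⊗_
  ; -_                = neg
  ; 0#                = con 0
  ; 1#                = con 1
  ; isCommutativeRing = record
    { isRing = record
      { +-isAbelianGroup = record
        { isGroup = record
          { isMonoid = record
            { isSemigroup = record
              { isMagma = record { isEquivalence = isEquivalence ; ∙-cong = ⊕-cong }
              ; assoc   = ⊕-assoc
              }
            ; identity = comm∧idˡ⇒id ⊕-comm ⊕-idˡ
            }
          ; inverse = comm∧invʳ⇒inv ⊕-comm ⊕-invʳ
          ; ⁻¹-cong = neg-cong
          }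
        ; comm = ⊕-comm
        }
      ; *-cong     = ⊗-cong
      ; *-assoc    = ⊗-assoc
      ; *-identity = comm∧idˡ⇒id ⊗-comm ⊗-idˡ
      ; distrib    = comm∧distrˡ⇒distr ⊕-cong ⊗-comm distribˡ
      }
    ; *-comm = ⊗-comm
    }
  }
  where
  isEquivalence : IsEquivalence (PolyEq {V} p)
  isEquivalence = record { refl = ≈-refl ; sym = ≈-sym ; trans = ≈-trans }
  setoid : Setoid 0ℓ 0ℓ
  setoid = record { isEquivalence = isEquivalence }
  open Consequences setoid


-- Natural-number arithmetic is opened only from here on, since the ring module
-- above uses _+_ and _*_ for the ring operations.
open import Data.Nat using (_+_; _*_; _^_; _∸_; _≤_; NonZero)
open import Data.Nat.Tactic.RingSolver using (solve-∀)
open import Data.Fin using (Fin; zero; suc)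
open import Data.Sum using (_⊎_; inj₁; inj₂; [_,_]′)
open import Function using (_∘_; const)
open ≡ using (refl; cong; cong₂)

variable
  U V W X Y X′ Y′ : Set

module _ {p : ℕ} where

  subst-cong : {σ τ : U → Expr V} → (∀ u → PolyEq p (σ u) (τ u)) →
               ∀ e → PolyEq p (subst σ e) (subst τ e)
  subst-cong eq (var u) = eq u
  subst-cong eq (con n) = ≈-refl
  subst-cong eq (neg a) = neg-cong (subst-cong eq a)
  subst-cong eq (a ⊕ b) = ⊕-cong (subst-cong eq a) (subst-cong eq b)
  subst-cong eq (a ⊗ b) = ⊗-cong (subst-cong eq a) (subst-cong eq b)

  subst-commute : {σ : U → Expr V} {τ : U → Expr W} {σ′ : W → Expr X} {θ : V → Expr X} →
                  (∀ u → PolyEq p (subst σ′ (τ u)) (subst θ (σ u))) →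
                  ∀ e → PolyEq p (subst σ′ (subst τ e)) (subst θ (subst σ e))
  subst-commute eq (var u) = eq u
  subst-commute eq (con n) = ≈-refl
  subst-commute eq (neg a) = neg-cong (subst-commute eq a)
  subst-commute eq (a ⊕ b) = ⊕-cong (subst-commute eq a) (subst-commute eq b)
  subst-commute eq (a ⊗ b) = ⊗-cong (subst-commute eq a) (subst-commute eq b)

  subst-resp : (σ : U → Expr V) {a b : Expr U} → PolyEq p a b → PolyEq p (subst σ a) (subst σ b)
  subst-resp σ ≈-refl            = ≈-refl
  subst-resp σ (≈-sym eq)        = ≈-sym (subst-resp σ eq)
  subst-resp σ (≈-trans eq eq′)  = ≈-trans (subst-resp σ eq) (subst-resp σ eq′)
  subst-resp σ (⊕-cong eq eq′)   = ⊕-cong (subst-resp σ eq) (subst-resp σ eq′)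
  subst-resp σ (⊗-cong eq eq′)   = ⊗-cong (subst-resp σ eq) (subst-resp σ eq′)
  subst-resp σ (neg-cong eq)     = neg-cong (subst-resp σ eq)
  subst-resp σ (⊕-assoc a b c)   = ⊕-assoc _ _ _
  subst-resp σ (⊕-comm a b)      = ⊕-comm _ _
  subst-resp σ (⊕-idˡ a)         = ⊕-idˡ _
  subst-resp σ (⊕-invʳ a)        = ⊕-invʳ _
  subst-resp σ (⊗-assoc a b c)   = ⊗-assoc _ _ _
  subst-resp σ (⊗-comm a b)      = ⊗-comm _ _
  subst-resp σ (⊗-idˡ a)         = ⊗-idˡ _
  subst-resp σ (distribˡ a b c)  = distribˡ _ _ _
  subst-resp σ (con-+ m n)       = con-+ m n
  subst-resp σ (con-* m n)       = con-* m n
  subst-resp σ char              = char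

subst-sumE : (θ : V → Expr W) (n : ℕ) (f : Fin n → Expr V) →
             subst θ (sumE n f) ≡ sumE n (subst θ ∘ f)
subst-sumE θ zero    f = refl
subst-sumE θ (suc n) f = cong (subst θ (f zero) ⊕_) (subst-sumE θ n (f ∘ suc))

sumE-cong : (n : ℕ) {f g : Fin n → Expr V} → (∀ i → f i ≡ g i) → sumE n f ≡ sumE n g
sumE-cong zero    eq = refl
sumE-cong (suc n) eq = cong₂ _⊕_ (eq zero) (sumE-cong n (eq ∘ suc))

subst-algGates : (θ : V → Expr W) {b i : ℕ} (B : BSLP b i) (ins : Fin b → Expr V) (g : Fin i) →
                 subst θ (algGates B ins g) ≡ algGates B (subst θ ∘ ins) g
subst-algGates θ (B ▷ binp o)   ins zero    = refl
subst-algGates θ (B ▷ bnot a)   ins zero    = cong (con 1 ⊖_) (subst-algGates θ B ins a)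
subst-algGates θ (B ▷ band a c) ins zero    =
  cong₂ _⊗_ (subst-algGates θ B ins a) (subst-algGates θ B ins c)
subst-algGates θ (B ▷ bor a c)  ins zero    =
  cong₂ (λ x y → con 1 ⊖ ((con 1 ⊖ x) ⊗ (con 1 ⊖ y)))
        (subst-algGates θ B ins a) (subst-algGates θ B ins c)
subst-algGates θ (B ▷ _)        ins (suc g) = subst-algGates θ B ins g

subst-VAL-algOut : (p : ℕ) (pr : Prime p) {b : ℕ} (C : BoolCircuit b) (θ : Fin b → Expr W) →
                   subst θ (VAL p pr (algOut C var) ⊖ VAL p pr var) ≡
                   VAL p pr (algOut C θ) ⊖ VAL p pr θ
subst-VAL-algOut p pr {b} C θ = cong₂ _⊖_
  (≡.trans (subst-sumE θ b _)
           (sumE-cong b (λ o → cong (_ ⊗_) (subst-algGates θ (BoolCircuit.gates C) var (BoolCircuit.out C o)))))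
  (subst-sumE θ b _)

module Derivations (p : ℕ) where

  infix 4 _≈_
  _≈_ : Expr X → Expr X → Set
  _≈_ = PolyEq p

  ≡⇒≈ : {a b : Expr X} → a ≡ b → a ≈ b
  ≡⇒≈ refl = ≈-refl

  lift : Expr X → Expr (X ⊎ Y)
  lift = subst (var ∘ inj₁)

  plugAxioms : (Y → Expr X) → X ⊎ Y → Expr X
  plugAxioms F = [ var , F ]′

  plugZero : X ⊎ Y → Expr X
  plugZero = [ var , const (con 0) ]′

  record Derives (F : Y → Expr X) (e : Expr (X ⊎ Y)) (G : Expr X) : Set where
    constructor derives
    field
      at-axioms : subst (plugAxioms F) e ≈ G
      at-zero   : subst plugZero e ≈ con 0

  open Derives public

  subst-lift : (f : Y → Expr X) (A : Expr X) → subst [ var , f ]′ (lift A) ≡ A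
  subst-lift f (var x) = refl
  subst-lift f (con n) = refl
  subst-lift f (neg a) = cong neg (subst-lift f a)
  subst-lift f (a ⊕ b) = cong₂ _⊕_ (subst-lift f a) (subst-lift f b)
  subst-lift f (a ⊗ b) = cong₂ _⊗_ (subst-lift f a) (subst-lift f b)

  module _ {F : Y → Expr X} where

    Derives-resp : ∀ {e G G′} → G ≈ G′ → Derives F e G → Derives F e G′
    Derives-resp eq (derives d₁ d₀) = derives (≈-trans d₁ eq) d₀

    Derives-respˡ : ∀ {e e′ G} → e ≈ e′ → Derives F e G → Derives F e′ G
    Derives-respˡ eq (derives d₁ d₀) =
      derives (≈-trans (subst-resp _ (≈-sym eq)) d₁) (≈-trans (subst-resp _ (≈-sym eq)) d₀)

    Derives-⊕ : ∀ {e e′ G G′} → Derives F e G → Derives F e′ G′ → Derives F (e ⊕ e′) (G ⊕ G′)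
    Derives-⊕ (derives d₁ d₀) (derives d₁′ d₀′) =
      derives (⊕-cong d₁ d₁′) (≈-trans (⊕-cong d₀ d₀′) (⊕-idˡ _))

    Derives-scale : ∀ Q {e G} → Derives F e G → Derives F (lift Q ⊗ e) (Q ⊗ G)
    Derives-scale Q (derives d₁ d₀) = derives
      (⊗-cong (≡⇒≈ (subst-lift F Q)) d₁)
      (≈-trans (⊗-cong (≡⇒≈ (subst-lift _ Q)) d₀) (CommutativeRing.zeroʳ (polyCommutativeRing p _) Q))

  Derives-subst : {F : Y → Expr X} {F′ : Y′ → Expr X′} (θ : X → Expr X′) {π : Y → Expr (X′ ⊎ Y′)} →
                  (∀ y → Derives F′ (π y) (subst θ (F y))) →
                  ∀ {e G} → Derives F e G → Derives F′ (subst [ lift ∘ θ , π ]′ e) (subst θ G)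
  Derives-subst {F = F} {F′} θ {π} dπ {e} (derives d₁ d₀) = derives
    (≈-trans (subst-commute pointwise₁ e) (subst-resp θ d₁))
    (≈-trans (subst-commute pointwise₀ e) (subst-resp θ d₀))
    where
    pointwise₁ : ∀ v → subst (plugAxioms F′) ([ lift ∘ θ , π ]′ v) ≈ subst θ (plugAxioms F v)
    pointwise₁ (inj₁ x) = ≡⇒≈ (subst-lift F′ (θ x))
    pointwise₁ (inj₂ y) = at-axioms (dπ y)
    pointwise₀ : ∀ v → subst plugZero ([ lift ∘ θ , π ]′ v) ≈ subst θ (plugZero v)
    pointwise₀ (inj₁ x) = ≡⇒≈ (subst-lift _ (θ x))
    pointwise₀ (inj₂ y) = at-zero (dπ y)

  module _ {b r : ℕ} {F : Fin r → Expr (Fin b)} {G : Expr (Fin b)} where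

    IPS⇒Derives : (D : IPS p b r F G) → Derives F (AlgCircuit.output (IPS.circuit D)) G
    IPS⇒Derives D = derives
      (≈-trans (subst-cong {σ = plugAxioms F} (λ { (inj₁ _) → ≈-refl ; (inj₂ _) → ≈-refl }) P)
               (IPS.derives D))
      (≈-trans (subst-cong {σ = plugZero} (λ { (inj₁ _) → ≈-refl ; (inj₂ _) → ≈-refl }) P)
               (IPS.vanishes D))
      where
      P : Expr (Fin b ⊎ Fin r)
      P = AlgCircuit.output (IPS.circuit D)

    Derives⇒IPS : (C : AlgCircuit (Fin b ⊎ Fin r)) → Derives F (AlgCircuit.output C) G → IPS p b r F G
    Derives⇒IPS C (derives d₁ d₀) = record
      { circuit  = C
      ; derives  = ≈-trans (subst-cong {τ = plugAxioms F} (λ { (inj₁ _) → ≈-refl ; (inj₂ _) → ≈-refl }) P)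
                           d₁
      ; vanishes = ≈-trans (subst-cong {τ = plugZero} (λ { (inj₁ _) → ≈-refl ; (inj₂ _) → ≈-refl }) P)
                           d₀
      }
      where
      P : Expr (Fin b ⊎ Fin r)
      P = AlgCircuit.output C

[p∸1]x≈-x : (p : ℕ) {{_ : NonZero p}} (x : Expr V) → PolyEq p (con (p ∸ 1) ⊗ x) (neg x)
[p∸1]x≈-x {V} p x = ≈-trans (⊗-cong p∸1≈-1 ≈-refl) (-1*x≈-x x)
  where
  open CommutativeRing (polyCommutativeRing p V) using (ring; +-group)
  open import Algebra.Properties.Ring ring using (-1*x≈-x)
  open import Algebra.Properties.Group +-group using (inverseˡ-unique)
  p∸1≈-1 : PolyEq p (con (p ∸ 1)) (neg (con 1))
  p∸1≈-1 = inverseˡ-unique (con (p ∸ 1)) (con 1) (begin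
    con (p ∸ 1) ⊕ con 1   ≈⟨ con-+ (p ∸ 1) 1 ⟨
    con (p ∸ 1 + 1)       ≡⟨ cong con (ℕ.m∸n+n≡m (ℕ.>-nonZero⁻¹ p)) ⟩
    con p                 ≈⟨ char ⟩
    con 0                 ∎)
    where open import Relation.Binary.Reasoning.Setoid (CommutativeRing.setoid (polyCommutativeRing p V))

module Programs (p : ℕ) {{_ : NonZero p}} (V : Set) where
  open Derivations p using (_≈_; ≡⇒≈)

  variable
    i j k m n : ℕ

  infix 4 _⊑_
  data _⊑_ (c : ASLP V i) : ∀ {j} → ASLP V j → Set where
    ⊑-refl : c ⊑ c
    ⊑-snoc : {c′ : ASLP V j} {g : AGate V j} → c ⊑ c′ → c ⊑ c′ ▷ g

  ⊑-trans : {c : ASLP V i} {c′ : ASLP V j} {c″ : ASLP V k} → c ⊑ c′ → c′ ⊑ c″ → c ⊑ c″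
  ⊑-trans e ⊑-refl      = e
  ⊑-trans e (⊑-snoc e′) = ⊑-snoc (⊑-trans e e′)

  weaken : {c : ASLP V i} {c′ : ASLP V j} → c ⊑ c′ → Fin i → Fin j
  weaken ⊑-refl     f = f
  weaken (⊑-snoc e) f = suc (weaken e f)

  agates-weaken : {c : ASLP V i} {c′ : ASLP V j} (e : c ⊑ c′) (f : Fin i) →
                  agates c′ (weaken e f) ≡ agates c f
  agates-weaken ⊑-refl     f = refl
  agates-weaken (⊑-snoc e) f = agates-weaken e f

  value : ASLP V i → Fin i ⊎ V → Expr V
  value c = [ agates c , var ]′

  record Gate (c : ASLP V i) (E : Expr V) : Set where
    constructor _,_
    field
      gate     : Fin i
      computes : agates c gate ≈ E

  record Node (c : ASLP V i) (E : Expr V) : Set where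
    constructor _,_
    field
      node     : Fin i ⊎ V
      computes : value c node ≈ E

  module _ {E : Expr V} {c : ASLP V i} where

    Gate-weaken : {c′ : ASLP V j} → c ⊑ c′ → Gate c E → Gate c′ E
    Gate-weaken e (f , eq) = weaken e f , ≈-trans (≡⇒≈ (agates-weaken e f)) eq

    Node-weaken : {c′ : ASLP V j} → c ⊑ c′ → Node c E → Node c′ E
    Node-weaken e (inj₁ f , eq) = inj₁ (weaken e f) , Gate.computes (Gate-weaken e (f , eq))
    Node-weaken e (inj₂ v , eq) = inj₂ v , eq

    Gate⇒Node : Gate c E → Node c E
    Gate⇒Node (f , eq) = inj₁ f , eq

    Gate-resp : ∀ {E′} → E ≈ E′ → Gate c E → Gate c E′
    Gate-resp eq′ (f , eq) = f , ≈-trans eq eq′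

  Pred : Set₁
  Pred = ∀ {j} → ASLP V j → Set

  record Build (c : ASLP V i) (n : ℕ) (R : Pred) : Set where
    constructor grown
    field
      {size}    : ℕ
      {program} : ASLP V size
      extension : c ⊑ program
      bounded   : size ≤ n + i
      result    : R program

  module _ {c : ASLP V i} {R : Pred} where

    pure : R c → Build c 0 R
    pure r = grown ⊑-refl ℕ.≤-refl r

    -- The continuation's cost comes first, so that costs such as suc i * 27 and
    -- sumℕ (suc k) f unfold definitionally along the recursion.
    infixl 1 _>>=_
    _>>=_ : {S : Pred} → Build c n R → (∀ {j} {c′ : ASLP V j} → c ⊑ c′ → R c′ → Build c′ m S) →
            Build c (m + n) S
    _>>=_ {n} {m} (grown {j} e bd r) k with k e r
    ... | grown e′ bd′ s = grown (⊑-trans e e′) (ℕ.≤-trans bd′ m+j≤m+n+i) s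
      where
      m+j≤m+n+i : m + j ≤ m + n + i
      m+j≤m+n+i = ℕ.≤-trans (ℕ.+-monoʳ-≤ m bd) (ℕ.≤-reflexive (≡.sym (ℕ.+-assoc m n i)))

    infixr 2 _<$>_
    _<$>_ : {S : Pred} → (∀ {j} {c′ : ASLP V j} → c ⊑ c′ → R c′ → S c′) → Build c n R → Build c n S
    f <$> grown e bd r = grown e bd (f e r)

    Build-mono : n ≤ m → Build c n R → Build c m R
    Build-mono n≤m (grown e bd r) = grown e (ℕ.≤-trans bd (ℕ.+-monoˡ-≤ _ n≤m)) r

  module _ {c : ASLP V i} where

    materialize : ∀ {E} → Node c E → Build c 1 (λ c′ → Gate c′ E)
    materialize (inj₁ f , eq) = grown ⊑-refl (ℕ.n≤1+n i) (f , eq)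
    materialize (inj₂ v , eq) = grown (⊑-snoc {g = gvar v} ⊑-refl) ℕ.≤-refl (zero , eq)

    emitCon : ∀ n → Build c 1 (λ c′ → Gate c′ (con n))
    emitCon n = grown (⊑-snoc {g = gcon n} ⊑-refl) ℕ.≤-refl (zero , ≈-refl)

    emitAdd : ∀ {A B} → Gate c A → Gate c B → Build c 1 (λ c′ → Gate c′ (A ⊕ B))
    emitAdd (f , eqA) (g , eqB) = grown (⊑-snoc {g = gadd f g} ⊑-refl) ℕ.≤-refl (zero , ⊕-cong eqA eqB)

    emitMul : ∀ {A B} → Gate c A → Gate c B → Build c 1 (λ c′ → Gate c′ (A ⊗ B))
    emitMul (f , eqA) (g , eqB) = grown (⊑-snoc {g = gmul f g} ⊑-refl) ℕ.≤-refl (zero , ⊗-cong eqA eqB)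

  Leaf : ASLP V i → Set
  Leaf c = Σ (Expr V) (Node c)

  treeCost : {U : Set} → Expr U → ℕ
  treeCost (var _) = 1
  treeCost (con _) = 1
  treeCost (neg a) = 2 + treeCost a
  treeCost (a ⊕ b) = suc (treeCost b) + treeCost a
  treeCost (a ⊗ b) = suc (treeCost b) + treeCost a

  emitFrom : {c₀ : ASLP V i} {c : ASLP V j} (t : Expr (Leaf c₀)) → c₀ ⊑ c →
             Build c (treeCost t) (λ c′ → Gate c′ (subst proj₁ t))
  emitFrom (var (_ , h)) e = materialize (Node-weaken e h)
  emitFrom (con n)       e = emitCon n
  emitFrom (neg a)       e =
    -- there is no negation gate: − a is computed as (p − 1) · a
    emitFrom a e >>= λ e₁ ga →
    emitCon (p ∸ 1) >>= λ e₂ gm →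
    (λ _ g → Gate-resp ([p∸1]x≈-x p _) g) <$> emitMul gm (Gate-weaken e₂ ga)
  emitFrom (a ⊕ b)       e =
    emitFrom a e >>= λ e₁ ga →
    emitFrom b (⊑-trans e e₁) >>= λ e₂ gb →
    emitAdd (Gate-weaken e₂ ga) gb
  emitFrom (a ⊗ b)       e =
    emitFrom a e >>= λ e₁ ga →
    emitFrom b (⊑-trans e e₁) >>= λ e₂ gb →
    emitMul (Gate-weaken e₂ ga) gb

  emit : {c : ASLP V i} (t : Expr (Leaf c)) → Build c (treeCost t) (λ c′ → Gate c′ (subst proj₁ t))
  emit t = emitFrom t ⊑-refl

  module _ {U : Set} (τ : U → Expr V) where

    copy : {c : ASLP V i} (Q : ASLP U m) → (∀ u → Node c (τ u)) →
           Build c m (λ c′ → ∀ f → Gate c′ (subst τ (agates Q f)))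
    copy []      h = pure (λ ())
    copy (Q ▷ g) h =
      copy Q h >>= λ e gs →
      (λ e′ new → snoc gs e′ new) <$> copyGate g (Node-weaken e ∘ h) gs
      where
      copyGate : {c : ASLP V j} (g : AGate U _) → (∀ u → Node c (τ u)) →
                 (∀ f → Gate c (subst τ (agates Q f))) → Build c 1 (λ c′ → Gate c′ (subst τ (agates (Q ▷ g) zero)))
      copyGate (gvar u)   h gs = materialize (h u)
      copyGate (gcon n)   h gs = emitCon n
      copyGate (gadd a b) h gs = emitAdd (gs a) (gs b)
      copyGate (gmul a b) h gs = emitMul (gs a) (gs b)
      snoc : {c : ASLP V j} {c′ : ASLP V k} → (∀ f → Gate c (subst τ (agates Q f))) → c ⊑ c′ →
             Gate c′ (subst τ (agates (Q ▷ g) zero)) → ∀ f → Gate c′ (subst τ (agates (Q ▷ g) f))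
      snoc gs e new zero    = new
      snoc gs e new (suc f) = Gate-weaken e (gs f)

  circuitAt : ASLP V i → Fin i → AlgCircuit V
  circuitAt (c ▷ g) zero    = mkAlg _ (c ▷ g)
  circuitAt (c ▷ g) (suc f) = circuitAt c f

  circuitAt-output : (c : ASLP V i) (f : Fin i) → AlgCircuit.output (circuitAt c f) ≡ agates c f
  circuitAt-output (c ▷ g) zero    = refl
  circuitAt-output (c ▷ g) (suc f) = circuitAt-output c f

  circuitAt-size : (c : ASLP V i) (f : Fin i) → AlgCircuit.size (circuitAt c f) ≤ i
  circuitAt-size (c ▷ g) zero    = ℕ.≤-refl
  circuitAt-size (c ▷ g) (suc f) = ℕ.m≤n⇒m≤1+n (circuitAt-size c f)

module PolyIdentities (p : ℕ) (X : Set) where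
  open IntegerCoefficients.Solver (polyCommutativeRing p X) con con-+ con-* ≈-refl ≈-refl
    using (solve; _:=_; _:+_; _:*_; _:-_; K)

  1ᶻ : ℕ × ℕ
  1ᶻ = 1 , 0

  booleanity-not : ∀ A → PolyEq p ((A ⊗ A) ⊖ A) (((con 1 ⊖ A) ⊗ (con 1 ⊖ A)) ⊖ (con 1 ⊖ A))
  booleanity-not = solve 1 (λ A → (A :* A) :- A := ((K 1ᶻ :- A) :* (K 1ᶻ :- A)) :- (K 1ᶻ :- A)) ≈-refl

  booleanity-and : ∀ A B → PolyEq p (((B ⊗ B) ⊗ ((A ⊗ A) ⊖ A)) ⊕ (A ⊗ ((B ⊗ B) ⊖ B)))
                                      (((A ⊗ B) ⊗ (A ⊗ B)) ⊖ (A ⊗ B))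
  booleanity-and = solve 2 (λ A B → ((B :* B) :* ((A :* A) :- A)) :+ (A :* ((B :* B) :- B))
                                     := ((A :* B) :* (A :* B)) :- (A :* B)) ≈-refl

  telescope : ∀ x y z → PolyEq p ((x ⊖ y) ⊕ (y ⊖ z)) (x ⊖ z)
  telescope = solve 3 (λ x y z → (x :- y) :+ (y :- z) := x :- z) ≈-refl

sumℕ-≤ : (k : ℕ) {f g : Fin k → ℕ} (a : ℕ) → (∀ i → f i ≤ g i + a) → sumℕ k f ≤ sumℕ k g + k * a
sumℕ-≤ zero    a le = ℕ.z≤n
sumℕ-≤ (suc k) {f} {g} a le = ℕ.≤-trans (ℕ.+-mono-≤ (le zero) (sumℕ-≤ k a (le ∘ suc)))
                                       (ℕ.≤-reflexive (regroup (g zero) (sumℕ k (g ∘ suc)) a (k * a)))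
  where
  regroup : ∀ x y z w → (x + z) + (y + w) ≡ (x + y) + (z + w)
  regroup = solve-∀

overhead : ∀ k S a → 1 ≤ k → 2 + (S + k * a) ≤ S + k * (2 + a)
overhead (suc k) S a _ = ℕ.≤-trans (ℕ.m≤m+n _ (k * 2)) (ℕ.≤-reflexive (expand k S a))
  where
  expand : ∀ k S a → 2 + (S + (1 + k) * a) + k * 2 ≡ S + (1 + k) * (2 + a)
  expand = solve-∀

gate-budget : ∀ s → 2 + (3 + s * 27) ≤ 30 * suc s ^ 1
gate-budget s = ℕ.≤-trans (ℕ.m≤m+n _ (25 + s * 3)) (ℕ.≤-reflexive (expand s))
  where
  expand : ∀ x → 2 + (3 + x * 27) + (25 + x * 3) ≡ 30 * ((1 + x) * 1)
  expand = solve-∀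

module Composition (p : ℕ) (pr : Prime p) (b : ℕ) where
  instance
    _ : NonZero p
    _ = prime⇒nonZero pr

  Var : Set
  Var = Fin b ⊎ Fin b

  open Derivations p
  open Programs p Var
  open PolyIdentities p (Fin b)

  Invariance : BoolCircuit b → Set
  Invariance C = IPS p b b (boolAx b) (VAL p pr (algOut C var) ⊖ VAL p pr var)

  record Proves (c : ASLP Var i) (G : Expr (Fin b)) : Set where
    constructor proves
    field
      {witness} : Expr Var
      located   : Node c witness
      sound     : Derives (boolAx b) witness G

  record Certified (c : ASLP Var i) (A : Expr (Fin b)) : Set where
    constructor certified
    field
      computed : Node c (lift A)
      boolean  : Proves c ((A ⊗ A) ⊖ A)

  open Proves
  open Certified

  module _ {c : ASLP Var i} {c′ : ASLP Var j} (e : c ⊑ c′) where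

    Proves-weaken : ∀ {G} → Proves c G → Proves c′ G
    Proves-weaken (proves h d) = proves (Node-weaken e h) d

    Certified-weaken : ∀ {A} → Certified c A → Certified c′ A
    Certified-weaken (certified v π) = certified (Node-weaken e v) (Proves-weaken π)

  Proves-resp : {c : ASLP Var i} {G G′ : Expr (Fin b)} → G ≈ G′ → Proves c G → Proves c G′
  Proves-resp eq (proves h d) = proves h (Derives-resp eq d)

  certifyNot : {c : ASLP Var i} {A : Expr (Fin b)} → Certified c A →
               Build c 5 (λ c′ → Certified c′ (con 1 ⊖ A))
  certifyNot {A = A} (certified v π) =
    (λ e g → certified (Gate⇒Node g) (Proves-weaken e (Proves-resp (booleanity-not A) π)))
      <$> emit (con 1 ⊖ var (_ , v))

  certifyAnd : {c : ASLP Var i} {A B : Expr (Fin b)} → Certified c A → Certified c B →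
            Build c 12 (λ c′ → Certified c′ (A ⊗ B))
  certifyAnd {A = A} {B} (certified va (proves {πA} na da)) (certified vb (proves {πB} nb db)) =
    emit (var (_ , va) ⊗ var (_ , vb)) >>= λ e v →
    (λ e′ w → certified (Node-weaken e′ (Gate⇒Node v)) (proves (Gate⇒Node w) derivation))
      <$> emitFrom (((var (_ , vb) ⊗ var (_ , vb)) ⊗ var (_ , na)) ⊕ (var (_ , va) ⊗ var (_ , nb))) e
    where
    derivation : Derives (boolAx b) (((lift B ⊗ lift B) ⊗ πA) ⊕ (lift A ⊗ πB))
                                    (((A ⊗ B) ⊗ (A ⊗ B)) ⊖ (A ⊗ B))
    derivation = Derives-resp (booleanity-and A B)
                              (Derives-⊕ (Derives-scale (B ⊗ B) da) (Derives-scale A db))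

  certifyOr : {c : ASLP Var i} {A B : Expr (Fin b)} → Certified c A → Certified c B →
           Build c 27 (λ c′ → Certified c′ (con 1 ⊖ ((con 1 ⊖ A) ⊗ (con 1 ⊖ B))))
  certifyOr a b =
    certifyNot a >>= λ e₁ ¬a →
    certifyNot (Certified-weaken e₁ b) >>= λ e₂ ¬b →
    certifyAnd (Certified-weaken e₂ ¬a) ¬b >>= λ _ ¬a∧¬b →
    certifyNot ¬a∧¬b

  certifyGates : {c : ASLP Var j} {T : Fin b → Expr (Fin b)} (B : BSLP b i) → (∀ o → Certified c (T o)) →
                 Build c (i * 27) (λ c′ → ∀ g → Certified c′ (algGates B T g))
  certifyGates []      ins = pure (λ ())
  certifyGates {T = T} (B ▷ g) ins =
    certifyGates B ins >>= λ e cs →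
    (λ e′ new → snoc cs e′ new) <$> certifyGate g (Certified-weaken e ∘ ins) cs
    where
    certifyGate : {c : ASLP Var j} (g : BGate b _) → (∀ o → Certified c (T o)) →
                  (∀ f → Certified c (algGates B T f)) →
                  Build c 27 (λ c′ → Certified c′ (algGates (B ▷ g) T zero))
    certifyGate (binp o)    ins cs = Build-mono ℕ.z≤n (pure (ins o))
    certifyGate (bnot a)    ins cs = Build-mono (ℕ.m≤m+n 5 22) (certifyNot (cs a))
    certifyGate (band a a′) ins cs = Build-mono (ℕ.m≤m+n 12 15) (certifyAnd (cs a) (cs a′))
    certifyGate (bor a a′)  ins cs = certifyOr (cs a) (cs a′)
    snoc : {c : ASLP Var j} {c′ : ASLP Var k} → (∀ f → Certified c (algGates B T f)) → c ⊑ c′ →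
           Certified c′ (algGates (B ▷ g) T zero) → ∀ f → Certified c′ (algGates (B ▷ g) T f)
    snoc cs e new zero    = new
    snoc cs e new (suc f) = Certified-weaken e (cs f)

  record Stage (c : ASLP Var i) (T₀ T : Fin b → Expr (Fin b)) : Set where
    constructor stage
    field
      outputs  : ∀ o → Certified c (T o)
      progress : Proves c (VAL p pr T ⊖ VAL p pr T₀)

  open Stage

  stepCost : (C : BoolCircuit b) → Invariance C → ℕ
  stepCost C D = (3 + IPS.size D) + BoolCircuit.size C * 27

  certifyStep : {c : ASLP Var i} {T₀ T : Fin b → Expr (Fin b)} (C : BoolCircuit b) (D : Invariance C) →
                Stage c T₀ T → Build c (stepCost C D) (λ c′ → Stage c′ T₀ (algOut C T))
  certifyStep {c = c} {T₀} {T} C D (stage outs acc) =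
    certifyGates (BoolCircuit.gates C) outs >>= λ e₁ cs →
    copy τ (AlgCircuit.gates (IPS.circuit D)) (handles e₁) >>= λ e₂ ds →
    (λ e₃ g → stage (λ o → Certified-weaken (⊑-trans e₂ e₃) (cs (BoolCircuit.out C o)))
                    (proves (Gate⇒Node g) (derivation (witness acc) (sound acc))))
      <$> emit (var (_ , Gate⇒Node (ds zero)) ⊕ var (_ , Node-weaken (⊑-trans e₁ e₂) (located acc)))
    where
    τ : Var → Expr Var
    τ = [ lift ∘ T , witness ∘ boolean ∘ outs ]′
    handles : {c′ : ASLP Var j} → c ⊑ c′ → ∀ v → Node c′ (τ v)
    handles e (inj₁ o) = Node-weaken e (computed (outs o))
    handles e (inj₂ o) = Node-weaken e (located (boolean (outs o)))
    derivation : ∀ π → Derives (boolAx b) π (VAL p pr T ⊖ VAL p pr T₀) →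
                 Derives (boolAx b) (subst τ (AlgCircuit.output (IPS.circuit D)) ⊕ π)
                                    (VAL p pr (algOut C T) ⊖ VAL p pr T₀)
    derivation π dπ =
      Derives-resp (≈-trans (⊕-cong (≡⇒≈ (subst-VAL-algOut p pr C T)) ≈-refl) (telescope _ _ _))
                   (Derives-⊕ (Derives-subst T (sound ∘ boolean ∘ outs) (IPS⇒Derives D)) dπ)

  compositionCost : (k : ℕ) (Cs : Fin k → BoolCircuit b) → ((i : Fin k) → Invariance (Cs i)) → ℕ
  compositionCost k Cs Ds = sumℕ k (λ i → stepCost (Cs i) (Ds i))

  certifyComposition : {c : ASLP Var i} {T₀ T : Fin b → Expr (Fin b)}
                       (k : ℕ) (Cs : Fin k → BoolCircuit b) (Ds : (i : Fin k) → Invariance (Cs i)) →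
                       Stage c T₀ T → Build c (compositionCost k Cs Ds) (λ c′ → Stage c′ T₀ (compose k Cs T))
  certifyComposition zero    Cs Ds s = pure s
  certifyComposition (suc k) Cs Ds s =
    certifyComposition k (Cs ∘ suc) (λ i → Ds (suc i)) s >>= λ _ s′ →
    certifyStep (Cs zero) (Ds zero) s′

  inputs : {c : ASLP Var i} (o : Fin b) → Certified c (var o)
  inputs o = certified (inj₂ (inj₁ o) , ≈-refl) (proves (inj₂ (inj₂ o) , ≈-refl) (derives ≈-refl ≈-refl))

  Derived : Expr (Fin b) → Pred
  Derived G c = Σ (Expr Var) λ w → Gate c w × Derives (boolAx b) w G

  Build⇒IPS : ∀ {n G} → Build [] n (Derived G) → Σ (IPS p b b (boolAx b) G) λ D → IPS.size D ≤ n
  Build⇒IPS {n} (grown {program = c} _ bd (w , (f , eq) , d)) =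
    Derives⇒IPS (circuitAt c f) (Derives-respˡ (≈-sym output≈w) d) ,
    ℕ.≤-trans (circuitAt-size c f) (ℕ.≤-trans bd (ℕ.≤-reflexive (ℕ.+-identityʳ n)))
    where
    output≈w : AlgCircuit.output (circuitAt c f) ≈ w
    output≈w = ≈-trans (≡⇒≈ (circuitAt-output c f)) eq

  composedInvariance : (k : ℕ) (Cs : Fin k → BoolCircuit b) (Ds : (i : Fin k) → Invariance (Cs i)) →
                       Σ (IPS p b b (boolAx b) (VAL p pr (compose k Cs var) ⊖ VAL p pr var)) λ D →
                         IPS.size D ≤ 2 + compositionCost k Cs Ds
  composedInvariance k Cs Ds =
    let D , D≤ = Build⇒IPS (
          emit (con 0) >>= λ _ z →
          certifyComposition k Cs Ds (stage inputs (proves (Gate⇒Node z) (derives (≈-sym (⊕-invʳ _)) ≈-refl)))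
            >>= λ _ s →
          (λ _ g → _ , g , sound (progress s)) <$> materialize (located (progress s)))
    in D , ℕ.≤-trans D≤ (ℕ.≤-reflexive (ℕ.+-comm (1 + compositionCost k Cs Ds) 1))

  compositionCost-≤ : (k : ℕ) (Cs : Fin k → BoolCircuit b) (Ds : (i : Fin k) → Invariance (Cs i)) (s : ℕ) →
                      ((i : Fin k) → BoolCircuit.size (Cs i) ≤ s) →
                      compositionCost k Cs Ds ≤ sumℕ k (λ i → IPS.size (Ds i)) + k * (3 + s * 27)
  compositionCost-≤ k Cs Ds s bounded = sumℕ-≤ k (3 + s * 27) λ i →
    ℕ.≤-trans (ℕ.+-monoʳ-≤ (3 + IPS.size (Ds i)) (ℕ.*-monoˡ-≤ 27 (bounded i)))
              (ℕ.≤-reflexive (regroup (IPS.size (Ds i)) s))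
    where
    regroup : ∀ t x → (3 + t) + x * 27 ≡ t + (3 + x * 27)
    regroup = solve-∀

corollary5p7 : Σ ℕ λ c → Σ ℕ λ d →
    (p : ℕ) → (pr : Prime p) → (b s k : ℕ) → 1 ≤ k →
    (Cs : Fin k → BoolCircuit b) →
    ((i : Fin k) → BoolCircuit.size (Cs i) ≤ s) →
    (Ds : (i : Fin k) →
      IPS p b b (boolAx b) (VAL p pr (algOut (Cs i) var) ⊖ VAL p pr var)) →
    Σ (IPS p b b (boolAx b) (VAL p pr (compose k Cs var) ⊖ VAL p pr var)) λ D →
      IPS.size D ≤ sumℕ k (λ i → IPS.size (Ds i)) + k * (c * suc s ^ d)
corollary5p7 = 30 , 1 , λ p pr b s k 1≤k Cs bounded Ds →
  let open Composition p pr b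
      (D , D≤) = composedInvariance k Cs Ds
      S = sumℕ k (λ i → IPS.size (Ds i))
  in D , (begin
    IPS.size D                                   ≤⟨ D≤ ⟩
    2 + compositionCost k Cs Ds                  ≤⟨ ℕ.+-monoʳ-≤ 2 (compositionCost-≤ k Cs Ds s bounded) ⟩
    2 + (S + k * (3 + s * 27))                   ≤⟨ overhead k S (3 + s * 27) 1≤k ⟩
    S + k * (2 + (3 + s * 27))                   ≤⟨ ℕ.+-monoʳ-≤ S (ℕ.*-monoʳ-≤ k (gate-budget s)) ⟩
    S + k * (30 * suc s ^ 1)                     ∎)
  where open ℕ.≤-Reasoning
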